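{- Let $G$ be an $r$-regular finite bipartite graph. Then $mp_f(G)=mp(G)=r$.
   Context: For a graph $G$ with an even number of vertices, the matching preclusion number $mp(G)$ is the minimum number of edges whose deletion leaves a graph with no perfect matching. Let $\mathcal{M}(G)$ be the set of perfect matchings of $G$ and $\bm{q}^M\in\mathbb{R}^{E(G)}$ the incidence vector of $M$. The fractional matching preclusion number $mp_f(G)$ is the optimal value of the linear program: minimize $\bm{1}^T\bm{y}$ over $\bm{y}\in\mathbb{R}^{E(G)}$ subject to $(\bm{q}^M)^T\bm{y}\geqslant 1$ for every $M\in\mathcal{M}(G)$ and $\bm{y}\geqslant 0$.
   Formalization: In the linear program defining $mp_f(G)$, the variable $\bm{y}$ has rational entries instead of real ones. -}

module Defs where

open import Data.Nat using (ℕ; zero; suc)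
open import Data.Bool using (Bool; true; false; if_then_else_; _∧_; _∨_; not)
open import Data.Fin using (Fin; zero; suc; _≟_)
open import Data.Fin.Subset using (Subset; ∣_∣)
open import Data.Vec using (lookup)
open import Data.Product using (Σ; _×_; _,_; ∃)
open import Data.Sum using (_⊎_)
open import Relation.Nullary using (¬_; does)
open import Relation.Binary.PropositionalEquality using (_≡_; _≢_)
open import Data.Integer using (+_)
open import Data.Rational as ℚ using (ℚ; 0ℚ; 1ℚ; _/_)

record Graph : Set where
  field
    n    : ℕ
    m    : ℕ
    end₁ : Fin m → Fin n
    end₂ : Fin m → Fin n
    noLoop : ∀ e → end₁ e ≢ end₂ e
    simple : ∀ e f →
      ((end₁ e ≡ end₁ f × end₂ e ≡ end₂ f) ⊎ (end₁ e ≡ end₂ f × end₂ e ≡ end₁ f)) →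
      e ≡ f

open Graph public

count : ∀ {k} → (Fin k → Bool) → ℕ
count {zero}  P = 0
count {suc k} P = (if P zero then 1 else 0) Data.Nat.+ count (λ i → P (suc i))

sumℚ : ∀ {k} → (Fin k → ℚ) → ℚ
sumℚ {zero}  f = 0ℚ
sumℚ {suc k} f = f zero ℚ.+ sumℚ (λ i → f (suc i))

incident : (G : Graph) → Fin (n G) → Fin (m G) → Bool
incident G v e = does (v ≟ end₁ G e) ∨ does (v ≟ end₂ G e)

degree : (G : Graph) → Fin (n G) → ℕ
degree G v = count (incident G v)

Regular : ℕ → Graph → Set
Regular r G = ∀ v → degree G v ≡ r

Bipartite : Graph → Set
Bipartite G = ∃ λ (c : Fin (n G) → Bool) → ∀ e → c (end₁ G e) ≢ c (end₂ G e)

EvenOrder : Graph → Set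
EvenOrder G = ∃ λ k → n G ≡ k Data.Nat.+ k

IsPerfectMatching : (G : Graph) → Subset (m G) → Set
IsPerfectMatching G M = ∀ v → count (λ e → lookup M e ∧ incident G v e) ≡ 1

-- Perfect matchings of G − F (G with the edges of F deleted):
-- perfect matchings of G using no edge of F.
IsPerfectMatchingOfDeletion : (G : Graph) → Subset (m G) → Subset (m G) → Set
IsPerfectMatchingOfDeletion G F M =
  IsPerfectMatching G M × (∀ e → lookup M e ≡ true → lookup F e ≡ false)

HasPerfectMatchingAfterDeleting : (G : Graph) → Subset (m G) → Set
HasPerfectMatchingAfterDeleting G F = ∃ λ M → IsPerfectMatchingOfDeletion G F M

MatchingPreclusionNumber : Graph → ℕ → Set
MatchingPreclusionNumber G k =
  (∃ λ F → ∣ F ∣ ≡ k × ¬ HasPerfectMatchingAfterDeleting G F) ×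
  (∀ F → ¬ HasPerfectMatchingAfterDeleting G F → k Data.Nat.≤ ∣ F ∣)

incidenceDot : (G : Graph) → Subset (m G) → (Fin (m G) → ℚ) → ℚ
incidenceDot G M y = sumℚ (λ e → if lookup M e then y e else 0ℚ)

Feasible : (G : Graph) → (Fin (m G) → ℚ) → Set
Feasible G y =
  (∀ e → 0ℚ ℚ.≤ y e) ×
  (∀ M → IsPerfectMatching G M → 1ℚ ℚ.≤ incidenceDot G M y)

objective : (G : Graph) → (Fin (m G) → ℚ) → ℚ
objective G y = sumℚ y

FractionalMatchingPreclusionNumber : Graph → ℚ → Set
FractionalMatchingPreclusionNumber G v =
  (∃ λ y → Feasible G y × objective G y ≡ v) ×
  (∀ y → Feasible G y → v ℚ.≤ objective G y)

ℕtoℚ : ℕ → ℚ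
ℕtoℚ k = (+ k) / 1

-- A perfect matching uses an edge at every vertex, so the r edges at a vertex
-- meet every perfect matching; in general the indicator vector of any such edge
-- set is LP-feasible, which gives mp_f ≤ mp ≤ r. Conversely, Hall's theorem (in
-- its deletion proof) shows that a regular bipartite graph has a perfect matching,
-- and removing it leaves an (r − 1)-regular graph; so E(G) is a disjoint union of
-- r perfect matchings, each of weight at least 1 under a feasible y, and 1ᵀy ≥ r.

module Submission where

open import Defs
import Algebra.Properties.CommutativeMonoid.Sum as CommutativeMonoidSum
import Algebra.Properties.Semiring.Sum as SemiringSum
open import Data.Bool using (Bool; true; false; if_then_else_; _∧_; _∨_; not)
import Data.Bool.Properties as BoolP
open import Data.Bool.Properties
  using (∧-conicalˡ; ∧-conicalʳ; ∧-identityʳ; ∧-zeroʳ; ∧-distribˡ-∨; ¬-not; not-¬)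
open import Data.Empty using (⊥; ⊥-elim)
open import Data.Fin as Fin using (Fin; zero; suc; _≟_)
import Data.Fin.Properties as FinP
open import Data.Fin.Subset using (Subset; ∣_∣)
open import Data.Fin.Subset.Properties using (anySubset?)
open import Data.Nat as ℕ using (ℕ; zero; suc; _+_; _*_; _≤_; _<_; _≥_; z≤n; s≤s)
import Data.Nat.Properties as ℕP
open import Data.Nat.Induction using (<-wellFounded)
import Data.Nat.Coprimality as Coprimality
import Data.Integer as ℤ
import Data.Integer.Properties as ℤP
open import Data.Rational as ℚ using (ℚ; 0ℚ; 1ℚ; mkℚ)
import Data.Rational.Properties as ℚP
import Data.Rational.Unnormalised as ℚᵘ
import Data.Rational.Unnormalised.Properties as ℚᵘP
open import Data.Product using (Σ; _×_; _,_; ∃; proj₁; proj₂)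
open import Data.Sum using (_⊎_; inj₁; inj₂)
open import Data.Vec using ([]; _∷_; lookup; tabulate)
open import Data.Vec.Properties using (lookup∘tabulate)
open import Function using (_∘_)
open import Function.Definitions using (Injective)
open import Induction.WellFounded using (module All)
open import Relation.Binary.Construct.On using (wellFounded)
open import Relation.Binary.PropositionalEquality
open import Relation.Nullary using (¬_; does; yes; no)
open import Relation.Nullary.Decidable using (dec-true; dec-false; toSum)

∧-true : ∀ {a b} → a ≡ true → b ≡ true → a ∧ b ≡ true
∧-true refl refl = refl

∨-trueˡ : ∀ {a} b → a ≡ true → a ∨ b ≡ true
∨-trueˡ b refl = refl

∨-trueʳ : ∀ a {b} → b ≡ true → a ∨ b ≡ true
∨-trueʳ true  _ = refl
∨-trueʳ false p = p

∨-true-elim : ∀ a b → a ∨ b ≡ true → a ≡ true ⊎ b ≡ true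
∨-true-elim true  _ _ = inj₁ refl
∨-true-elim false _ p = inj₂ p

_⊆_ : ∀ {k} → (Fin k → Bool) → (Fin k → Bool) → Set
P ⊆ Q = ∀ i → P i ≡ true → Q i ≡ true

_==_ : ∀ {k} → Fin k → Fin k → Bool
i == j = does (i ≟ j)

==⇒≡ : ∀ {k} {i j : Fin k} → i == j ≡ true → i ≡ j
==⇒≡ {i = i} {j} p with i ≟ j
... | yes i≡j = i≡j

==-refl : ∀ {k} (i : Fin k) → i == i ≡ true
==-refl i = dec-true (i ≟ i) refl

≢⇒==-false : ∀ {k} {i j : Fin k} → i ≢ j → i == j ≡ false
≢⇒==-false {i = i} {j} = dec-false (i ≟ j)

toℕ : Bool → ℕ
toℕ b = if b then 1 else 0

toℕ-mono : ∀ {a b} → (a ≡ true → b ≡ true) → toℕ a ≤ toℕ b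
toℕ-mono {false} _ = z≤n
toℕ-mono {true}  h rewrite h refl = ℕP.≤-refl

module ΣNat = SemiringSum ℕP.+-*-semiring
open ΣNat using (sum; sum-cong-≗; ∑-distrib-+; ∑-comm; sum-replicate-zero; *-distribʳ-sum)

sum-mono : ∀ {k} {f g : Fin k → ℕ} → (∀ i → f i ≤ g i) → sum f ≤ sum g
sum-mono {zero}  _ = z≤n
sum-mono {suc k} h = ℕP.+-mono-≤ (h zero) (sum-mono (h ∘ suc))

sum-mono-< : ∀ {k} {f g : Fin k → ℕ} → (∀ i → f i ≤ g i) → ∀ j → f j < g j → sum f < sum g
sum-mono-< {suc k} h zero    lt = ℕP.+-mono-<-≤ lt (sum-mono (h ∘ suc))
sum-mono-< {suc k} h (suc j) lt = ℕP.+-mono-≤-< (h zero) (sum-mono-< (h ∘ suc) j lt)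

count≡sum : ∀ {k} (P : Fin k → Bool) → count P ≡ sum (toℕ ∘ P)
count≡sum {zero}  P = refl
count≡sum {suc k} P = cong (toℕ (P zero) +_) (count≡sum (P ∘ suc))

count-cong : ∀ {k} {P Q : Fin k → Bool} → (∀ i → P i ≡ Q i) → count P ≡ count Q
count-cong {P = P} {Q} h =
  trans (count≡sum P) (trans (sum-cong-≗ (cong toℕ ∘ h)) (sym (count≡sum Q)))

count-mono : ∀ {k} {P Q : Fin k → Bool} → P ⊆ Q → count P ≤ count Q
count-mono {P = P} {Q} h rewrite count≡sum P | count≡sum Q = sum-mono (toℕ-mono ∘ h)

count-none : ∀ {k} {P : Fin k → Bool} → (∀ i → P i ≡ false) → count P ≡ 0
count-none {k} {P} h =
  trans (count-cong h) (trans (count≡sum {k} (λ _ → false)) (sum-replicate-zero k))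

count-pointwise-+ : ∀ {k} (P Q R S : Fin k → Bool) →
  (∀ i → toℕ (P i) + toℕ (Q i) ≡ toℕ (R i) + toℕ (S i)) →
  count P + count Q ≡ count R + count S
count-pointwise-+ P Q R S h = begin
  count P + count Q                 ≡⟨ cong₂ _+_ (count≡sum P) (count≡sum Q) ⟩
  sum (toℕ ∘ P) + sum (toℕ ∘ Q)     ≡⟨ ∑-distrib-+ (toℕ ∘ P) (toℕ ∘ Q) ⟨
  sum (λ i → toℕ (P i) + toℕ (Q i)) ≡⟨ sum-cong-≗ h ⟩
  sum (λ i → toℕ (R i) + toℕ (S i)) ≡⟨ ∑-distrib-+ (toℕ ∘ R) (toℕ ∘ S) ⟩
  sum (toℕ ∘ R) + sum (toℕ ∘ S)     ≡⟨ cong₂ _+_ (count≡sum R) (count≡sum S) ⟨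
  count R + count S                 ∎
  where open ≡-Reasoning

count-∨-∧ : ∀ {k} (P Q : Fin k → Bool) →
  count (λ i → P i ∨ Q i) + count (λ i → P i ∧ Q i) ≡ count P + count Q
count-∨-∧ P Q = count-pointwise-+ _ _ P Q (λ i → lemma (P i) (Q i))
  where
  lemma : ∀ a b → toℕ (a ∨ b) + toℕ (a ∧ b) ≡ toℕ a + toℕ b
  lemma true  true  = refl
  lemma true  false = refl
  lemma false b     = ℕP.+-identityʳ _

count-split : ∀ {k} (P Q : Fin k → Bool) →
  count P ≡ count (λ i → P i ∧ not (Q i)) + count (λ i → P i ∧ Q i)
count-split {k} P Q =
  trans (sym (ℕP.+-identityʳ (count P)))
    (trans (cong (count P +_) (sym (count-none {k} {λ _ → false} λ _ → refl)))
      (count-pointwise-+ P (λ _ → false) _ _ (λ i → lemma (P i) (Q i))))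
  where
  lemma : ∀ a b → toℕ a + 0 ≡ toℕ (a ∧ not b) + toℕ (a ∧ b)
  lemma true  true  = refl
  lemma true  false = refl
  lemma false b     = refl

count-witness : ∀ {k} (P : Fin k → Bool) → 1 ≤ count P → ∃ λ i → P i ≡ true
count-witness {suc k} P h with P zero in eq
... | true  = zero , eq
... | false = let (i , p) = count-witness (P ∘ suc) h in suc i , p

count-two-witnesses : ∀ {k} (P : Fin k → Bool) → 2 ≤ count P →
  Σ (Fin k) λ i → Σ (Fin k) λ j → i ≢ j × P i ≡ true × P j ≡ true
count-two-witnesses {suc k} P h with P zero in eq
... | true  = let (j , p) = count-witness (P ∘ suc) (ℕP.≤-pred h) in zero , suc j , (λ ()) , eq , p
... | false = let (i , j , i≢j , p , q) = count-two-witnesses (P ∘ suc) h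
              in suc i , suc j , i≢j ∘ FinP.suc-injective , p , q

count-== : ∀ {k} (i : Fin k) → count (_== i) ≡ 1
count-== {suc k} zero    = cong suc (count-none {k} (λ j → ≢⇒==-false {i = suc j} {zero} λ ()))
count-== {suc k} (suc i) = count-== i

count-unique : ∀ {k} (P : Fin k → Bool) i → P i ≡ true → (∀ j → P j ≡ true → j ≡ i) →
  count P ≡ 1
count-unique P i p unique = trans (count-cong P≡[_==i]) (count-== i)
  where
  P≡[_==i] : ∀ j → P j ≡ (j == i)
  P≡[_==i] j with j ≟ i
  ... | yes refl = p
  ... | no j≢i   = ¬-not (j≢i ∘ unique j)

count-≥1 : ∀ {k} (P : Fin k → Bool) i → P i ≡ true → 1 ≤ count P
count-≥1 P i p = subst (_≤ count P) (count-== i)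
  (count-mono {Q = P} (λ j j==i → subst (λ z → P z ≡ true) (sym (==⇒≡ {i = j} {i} j==i)) p))

count-pair : ∀ {k} {i j : Fin k} → i ≢ j → count (λ z → z == i ∨ z == j) ≡ 2
count-pair {k} {i} {j} i≢j = begin
  count pair                                            ≡⟨ ℕP.+-identityʳ _ ⟨
  count pair + 0                                        ≡⟨ cong (count pair +_) (count-none both-false) ⟨
  count pair + count (λ z → z == i ∧ z == j)            ≡⟨ count-∨-∧ (_== i) (_== j) ⟩
  count (_== i) + count (_== j)                         ≡⟨ cong₂ _+_ (count-== i) (count-== j) ⟩
  2                                                     ∎
  where
  open ≡-Reasoning
  pair : Fin k → Bool
  pair z = z == i ∨ z == j
  both-false : ∀ z → (z == i ∧ z == j) ≡ false
  both-false z = ¬-not λ p → i≢j (trans (sym (==⇒≡ {i = z} (∧-conicalˡ (z == i) _ p)))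
                                        (==⇒≡ {i = z} (∧-conicalʳ (z == i) _ p)))

count≤1⇒unique : ∀ {k} (P : Fin k → Bool) → count P ≤ 1 →
  ∀ i j → P i ≡ true → P j ≡ true → i ≡ j
count≤1⇒unique P h i j p q with i ≟ j
... | yes i≡j = i≡j
... | no  i≢j = ⊥-elim (ℕP.<⇒≱ (subst (_≤ count P) (count-pair i≢j) (count-mono pair⊆P)) h)
  where
  pair⊆P : ∀ z → (z == i ∨ z == j) ≡ true → P z ≡ true
  pair⊆P z r with ∨-true-elim (z == i) (z == j) r
  ... | inj₁ z==i = subst (λ w → P w ≡ true) (sym (==⇒≡ {i = z} z==i)) p
  ... | inj₂ z==j = subst (λ w → P w ≡ true) (sym (==⇒≡ {i = z} z==j)) q

count-∧-== : ∀ {k} (T : Fin k → Bool) a → count (λ x → T x ∧ x == a) ≡ toℕ (T a)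
count-∧-== T a with T a in eq
... | true  = count-unique _ a (∧-true eq (==-refl a)) (λ x p → ==⇒≡ {i = x} (∧-conicalʳ (T x) _ p))
... | false = count-none λ x → ¬-not λ p →
  not-¬ (subst (λ t → T t ≡ true) (==⇒≡ {i = x} (∧-conicalʳ (T x) _ p)) (∧-conicalˡ (T x) _ p)) eq

exists : ∀ {k} → (Fin k → Bool) → Bool
exists P = does (FinP.any? (λ i → P i BoolP.≟ true))

exists-intro : ∀ {k} (P : Fin k → Bool) i → P i ≡ true → exists P ≡ true
exists-intro P i p = dec-true (FinP.any? (λ i → P i BoolP.≟ true)) (i , p)

exists-elim : ∀ {k} (P : Fin k → Bool) → exists P ≡ true → ∃ λ i → P i ≡ true
exists-elim P h with FinP.any? (λ i → P i BoolP.≟ true)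
... | yes witness = witness

-- Hall's theorem for a relation on Fin k × Fin k

module Hall {k : ℕ} where

  Relation : Set
  Relation = Fin k → Fin k → Bool

  Neighbourhood : Relation → (Fin k → Bool) → Fin k → Bool
  Neighbourhood R S y = exists (λ x → S x ∧ R x y)

  HallCondition : Relation → Set
  HallCondition R = ∀ S → count S ≤ count (Neighbourhood R S)

  Deficient : Relation → (Fin k → Bool) → Set
  Deficient R S = count (Neighbourhood R S) < count S

  Matching : Relation → Set
  Matching R = Σ (Fin k → Fin k) λ f → (∀ x → R x (f x) ≡ true) × Injective _≡_ _≡_ f

  size : Relation → ℕ
  size R = sum (λ x → count (R x))

  delete : Fin k → Fin k → Relation → Relation
  delete x y R a b = R a b ∧ not (a == x ∧ b == y)

  Neighbourhood-intro : ∀ R S {x y} → S x ≡ true → R x y ≡ true → Neighbourhood R S y ≡ true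
  Neighbourhood-intro R S {x} sx rxy = exists-intro _ x (∧-true sx rxy)

  Neighbourhood-elim : ∀ R S y → Neighbourhood R S y ≡ true → ∃ λ x → S x ≡ true × R x y ≡ true
  Neighbourhood-elim R S y h =
    let (x , p) = exists-elim _ h in x , ∧-conicalˡ (S x) _ p , ∧-conicalʳ (S x) _ p

  Neighbourhood-mono : ∀ R {S T} → S ⊆ T → Neighbourhood R S ⊆ Neighbourhood R T
  Neighbourhood-mono R S⊆T y h =
    let (x , sx , rxy) = Neighbourhood-elim R _ y h in Neighbourhood-intro R _ (S⊆T x sx) rxy

  matching-mono : ∀ {R R'} → (∀ a → R a ⊆ R' a) → Matching R → Matching R'
  matching-mono R⊆R' (f , related , injective) = f , (λ x → R⊆R' x (f x) (related x)) , injective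

  hallCondition? : ∀ R → HallCondition R ⊎ ∃ (Deficient R)
  hallCondition? R with anySubset? (λ S → count (Neighbourhood R (lookup S)) ℕ.<? count (lookup S))
  ... | yes (S , deficient) = inj₂ (lookup S , deficient)
  ... | no  ¬deficient      = inj₁ λ S →
    let S' = tabulate S
        S'≗S = lookup∘tabulate S
    in begin
      count S                                 ≡⟨ count-cong S'≗S ⟨
      count (lookup S')                       ≤⟨ ℕP.≮⇒≥ (¬deficient ∘ (S' ,_)) ⟩
      count (Neighbourhood R (lookup S'))     ≤⟨ count-mono (Neighbourhood-mono R (subst (_≡ true) ∘ S'≗S)) ⟩
      count (Neighbourhood R S)               ∎
    where open ℕP.≤-Reasoning

  delete-⊆ : ∀ x y R a → delete x y R a ⊆ R a
  delete-⊆ x y R a b = ∧-conicalˡ (R a b) _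

  delete-elsewhere : ∀ {x} y R {a} b → a ≢ x → delete x y R a b ≡ R a b
  delete-elsewhere y R {a} b a≢x rewrite ≢⇒==-false a≢x = ∧-identityʳ (R a b)

  delete-at : ∀ x {y} R {b} → b ≢ y → delete x y R x b ≡ R x b
  delete-at x R {b} b≢y rewrite ==-refl x | ≢⇒==-false b≢y = ∧-identityʳ (R x b)

  size-delete : ∀ x y R → R x y ≡ true → size (delete x y R) < size R
  size-delete x y R rxy = sum-mono-< (λ a → count-mono (delete-⊆ x y R a)) x (begin-strict
    count (delete x y R x)
      ≡⟨ count-cong (λ b → cong (λ t → R x b ∧ not (t ∧ b == y)) (==-refl x)) ⟩
    count other                             <⟨ ℕP.m<m+n _ (count-≥1 _ y (∧-true rxy (==-refl y))) ⟩
    count other + count (λ b → R x b ∧ b == y) ≡⟨ count-split (R x) (_== y) ⟨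
    count (R x)                             ∎)
    where
    open ℕP.≤-Reasoning
    other : Fin k → Bool
    other b = R x b ∧ not (b == y)

  matching-of-functional : ∀ R → HallCondition R → (∀ x → count (R x) ≤ 1) → Matching R
  matching-of-functional R hallR functional = f , related , injective
    where
    image : ∀ x → ∃ λ y → R x y ≡ true
    image x =
      let (y , y∈N) = count-witness (Neighbourhood R (_== x))
                        (subst (_≤ count (Neighbourhood R (_== x))) (count-== x) (hallR (_== x)))
          (x' , x'==x , rx'y) = Neighbourhood-elim R (_== x) y y∈N
      in y , subst (λ z → R z y ≡ true) (==⇒≡ {i = x'} x'==x) rx'y
    f : Fin k → Fin k
    f x = proj₁ (image x)
    related : ∀ x → R x (f x) ≡ true
    related x = proj₂ (image x)
    -- A pair {x, x'} with f x = f x' would have the single neighbour f x.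
    injective : Injective _≡_ _≡_ f
    injective {x} {x'} fx≡fx' with x ≟ x'
    ... | yes x≡x' = x≡x'
    ... | no  x≢x' = ⊥-elim (ℕP.<⇒≱
      (subst₂ _<_ (sym (count-== (f x))) (sym (count-pair x≢x')) (ℕP.n<1+n 1))
      (ℕP.≤-trans (hallR _) (count-mono N⊆[fx])))
      where
      N⊆[fx] : Neighbourhood R (λ z → z == x ∨ z == x') ⊆ (_== f x)
      N⊆[fx] y y∈N with Neighbourhood-elim R _ y y∈N
      ... | z , z∈pair , rzy with ∨-true-elim (z == x) (z == x') z∈pair
      ... | inj₁ z==x  rewrite ==⇒≡ {i = z} z==x =
        subst (λ t → (y == t) ≡ true)
          (count≤1⇒unique (R x) (functional x) y (f x) rzy (related x)) (==-refl y)
      ... | inj₂ z==x' rewrite ==⇒≡ {i = z} z==x' =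
        subst (λ t → (y == t) ≡ true)
          (trans (count≤1⇒unique (R x') (functional x') y (f x') rzy (related x')) (sym fx≡fx')) (==-refl y)

  deficient-contains : ∀ x y R → HallCondition R → ∀ A → Deficient (delete x y R) A → A x ≡ true
  deficient-contains x y R hallR A deficient with A x in eq
  ... | true  = refl
  ... | false = ⊥-elim (ℕP.<⇒≱ deficient (ℕP.≤-trans (hallR A) (count-mono {Q = N'} N⊆N')))
    where
    N' = Neighbourhood (delete x y R) A
    N⊆N' : Neighbourhood R A ⊆ N'
    N⊆N' b b∈N with Neighbourhood-elim R A b b∈N
    ... | a , a∈A , rab = Neighbourhood-intro (delete x y R) A a∈A (trans (delete-elsewhere y R b a≢x) rab)
      where
      a≢x : a ≢ x
      a≢x refl = not-¬ a∈A eq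

  -- Submodularity of |N(·)| with C = A ∪ B and D = (A ∩ B) ∖ {x}:
  -- |C| + |D| ≤ |N₁| + |N₂| < |A| + |B| − 1 = |C| + |D|.
  no-two-deficient : ∀ {x y₁ y₂} R → HallCondition R → y₁ ≢ y₂ → R x y₁ ≡ true →
    ∀ A B → Deficient (delete x y₁ R) A → Deficient (delete x y₂ R) B → ⊥
  no-two-deficient {x} {y₁} {y₂} R hallR y₁≢y₂ rxy₁ A B deficientA deficientB =
    ℕP.<-irrefl refl (begin-strict
      suc (n₁ + n₂)                                    <⟨ ℕP.n<1+n _ ⟩
      suc (suc (n₁ + n₂))                              ≡⟨ cong suc (ℕP.+-suc n₁ n₂) ⟨
      suc n₁ + suc n₂                                  ≤⟨ ℕP.+-mono-≤ deficientA deficientB ⟩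
      count A + count B                                ≡⟨ count-A+B ⟩
      suc (count C + count D)                          ≤⟨ s≤s (ℕP.+-mono-≤ (hallR C) (hallR D)) ⟩
      suc (count (Neighbourhood R C) + count (Neighbourhood R D))
                              ≤⟨ s≤s (ℕP.+-mono-≤ (count-mono N[C]⊆N₁∪N₂) (count-mono N[D]⊆N₁∩N₂)) ⟩
      suc (count (λ y → N₁ y ∨ N₂ y) + count (λ y → N₁ y ∧ N₂ y))
                              ≡⟨ cong suc (count-∨-∧ N₁ N₂) ⟩
      suc (n₁ + n₂)                                    ∎)
    where
    open ℕP.≤-Reasoning
    N₁ N₂ C D : Fin k → Bool
    N₁ = Neighbourhood (delete x y₁ R) A
    N₂ = Neighbourhood (delete x y₂ R) B
    C z = A z ∨ B z
    D z = (A z ∧ B z) ∧ not (z == x)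
    n₁ = count N₁
    n₂ = count N₂
    x∈A = deficient-contains x y₁ R hallR A deficientA
    x∈B = deficient-contains x y₂ R hallR B deficientB

    into-N₁ : ∀ {z y} → A z ≡ true → delete x y₁ R z y ≡ true → N₁ y ≡ true
    into-N₁ = Neighbourhood-intro (delete x y₁ R) A
    into-N₂ : ∀ {z y} → B z ≡ true → delete x y₂ R z y ≡ true → N₂ y ≡ true
    into-N₂ = Neighbourhood-intro (delete x y₂ R) B

    count-A+B : count A + count B ≡ suc (count C + count D)
    count-A+B = begin-equality
      count A + count B
        ≡⟨ count-∨-∧ A B ⟨
      count C + count (λ z → A z ∧ B z)
        ≡⟨ cong (count C +_) (count-split (λ z → A z ∧ B z) (_== x)) ⟩
      count C + (count D + count (λ z → (A z ∧ B z) ∧ z == x))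
        ≡⟨ cong (λ t → count C + (count D + t)) A∩B∩[x] ⟩
      count C + (count D + 1)
        ≡⟨ cong (count C +_) (ℕP.+-comm (count D) 1) ⟩
      count C + suc (count D)
        ≡⟨ ℕP.+-suc (count C) (count D) ⟩
      suc (count C + count D)
        ∎
      where
      A∩B∩[x] : count (λ z → (A z ∧ B z) ∧ z == x) ≡ 1
      A∩B∩[x] = count-unique _ x (∧-true (∧-true x∈A x∈B) (==-refl x))
                  (λ z p → ==⇒≡ {i = z} (∧-conicalʳ (A z ∧ B z) _ p))

    N[C]⊆N₁∪N₂ : Neighbourhood R C ⊆ (λ y → N₁ y ∨ N₂ y)
    N[C]⊆N₁∪N₂ y y∈N with Neighbourhood-elim R C y y∈N
    ... | z , z∈C , rzy with z ≟ x
    ... | yes refl with toSum (y ≟ y₁)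
    ...   | inj₁ refl = ∨-trueʳ (N₁ y) (into-N₂ x∈B (trans (delete-at x R y₁≢y₂) rxy₁))
    ...   | inj₂ y≢y₁ = ∨-trueˡ (N₂ y) (into-N₁ x∈A (trans (delete-at x R y≢y₁) rzy))
    N[C]⊆N₁∪N₂ y y∈N | z , z∈C , rzy | no z≢x with ∨-true-elim (A z) (B z) z∈C
    ... | inj₁ z∈A = ∨-trueˡ (N₂ y) (into-N₁ z∈A (trans (delete-elsewhere y₁ R y z≢x) rzy))
    ... | inj₂ z∈B = ∨-trueʳ (N₁ y) (into-N₂ z∈B (trans (delete-elsewhere y₂ R y z≢x) rzy))

    N[D]⊆N₁∩N₂ : Neighbourhood R D ⊆ (λ y → N₁ y ∧ N₂ y)
    N[D]⊆N₁∩N₂ y y∈N with Neighbourhood-elim R D y y∈N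
    ... | z , z∈D , rzy =
      ∧-true (into-N₁ (∧-conicalˡ (A z) _ z∈A∩B) (trans (delete-elsewhere y₁ R y z≢x) rzy))
             (into-N₂ (∧-conicalʳ (A z) _ z∈A∩B) (trans (delete-elsewhere y₂ R y z≢x) rzy))
      where
      z∈A∩B = ∧-conicalˡ (A z ∧ B z) _ z∈D
      z≢x : z ≢ x
      z≢x refl with () ← subst (λ b → not b ≡ true) (==-refl z) (∧-conicalʳ (A z ∧ B z) _ z∈D)

  deletion-keeps-hall : ∀ {x y₁ y₂} R → HallCondition R →
    y₁ ≢ y₂ → R x y₁ ≡ true → R x y₂ ≡ true →
    HallCondition (delete x y₁ R) ⊎ HallCondition (delete x y₂ R)
  deletion-keeps-hall {x} {y₁} {y₂} R hallR y₁≢y₂ rxy₁ rxy₂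
    with hallCondition? (delete x y₁ R) | hallCondition? (delete x y₂ R)
  ... | inj₁ hall₁ | _           = inj₁ hall₁
  ... | inj₂ _     | inj₁ hall₂  = inj₂ hall₂
  ... | inj₂ (A , deficientA) | inj₂ (B , deficientB) =
    ⊥-elim (no-two-deficient R hallR y₁≢y₂ rxy₁ A B deficientA deficientB)

  -- Delete edges while Hall's condition survives; what remains is a matching.
  hall : ∀ R → HallCondition R → Matching R
  hall = All.wfRec (wellFounded size <-wellFounded) _ (λ R → HallCondition R → Matching R) step
    where
    step : ∀ R → (∀ {R'} → size R' < size R → HallCondition R' → Matching R') →
           HallCondition R → Matching R
    step R smaller hallR with FinP.any? (λ x → 2 ℕ.≤? count (R x))
    ... | no  ¬branching =
      matching-of-functional R hallR (λ x → ℕP.≤-pred (ℕP.≰⇒> (¬branching ∘ (x ,_))))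
    ... | yes (x , branching) with count-two-witnesses (R x) branching
    ... | y₁ , y₂ , y₁≢y₂ , rxy₁ , rxy₂ with deletion-keeps-hall R hallR y₁≢y₂ rxy₁ rxy₂
    ... | inj₁ hall₁ = matching-mono (delete-⊆ x y₁ R) (smaller (size-delete x y₁ R rxy₁) hall₁)
    ... | inj₂ hall₂ = matching-mono (delete-⊆ x y₂ R) (smaller (size-delete x y₂ R rxy₂) hall₂)

injective⇒surjective : ∀ {k} (f : Fin k → Fin k) → Injective _≡_ _≡_ f →
  ∀ v → ∃ λ u → f u ≡ v
injective⇒surjective {suc k} f injective v with FinP.any? (λ u → f u ≟ v)
... | yes hit = hit
... | no  miss = ⊥-elim (ℕP.<-irrefl refl (FinP.injective⇒≤ g-injective))
  where
  g : Fin (suc k) → Fin k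
  g u = Fin.punchOut (miss ∘ (u ,_) ∘ sym)
  g-injective : Injective _≡_ _≡_ g
  g-injective {x} {y} = injective ∘ FinP.punchOut-injective (miss ∘ (x ,_) ∘ sym) (miss ∘ (y ,_) ∘ sym)

module _ (G : Graph) where

  EdgeSet : Set
  EdgeSet = Fin (m G) → Bool

  degreeIn : EdgeSet → Fin (n G) → ℕ
  degreeIn E v = count (λ e → E e ∧ incident G v e)

  -- IsPerfectMatching G M is RegularEdgeSet 1 (lookup M) by definition.
  RegularEdgeSet : ℕ → EdgeSet → Set
  RegularEdgeSet k E = ∀ v → degreeIn E v ≡ k

  Joins : Fin (m G) → Fin (n G) → Fin (n G) → Set
  Joins e x y = (x ≡ end₁ G e × y ≡ end₂ G e) ⊎ (x ≡ end₂ G e × y ≡ end₁ G e)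

  joins : Fin (m G) → Fin (n G) → Fin (n G) → Bool
  joins e x y = (x == end₁ G e ∧ y == end₂ G e) ∨ (x == end₂ G e ∧ y == end₁ G e)

  joins⇒Joins : ∀ e x y → joins e x y ≡ true → Joins e x y
  joins⇒Joins e x y p with ∨-true-elim (x == end₁ G e ∧ y == end₂ G e) _ p
  ... | inj₁ q = inj₁ (==⇒≡ {i = x} (∧-conicalˡ (x == end₁ G e) _ q) ,
                       ==⇒≡ {i = y} (∧-conicalʳ (x == end₁ G e) _ q))
  ... | inj₂ q = inj₂ (==⇒≡ {i = x} (∧-conicalˡ (x == end₂ G e) _ q) ,
                       ==⇒≡ {i = y} (∧-conicalʳ (x == end₂ G e) _ q))

  joins-end₁-end₂ : ∀ e → joins e (end₁ G e) (end₂ G e) ≡ true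
  joins-end₁-end₂ e = ∨-trueˡ _ (∧-true (==-refl (end₁ G e)) (==-refl (end₂ G e)))

  joins-end₂-end₁ : ∀ e → joins e (end₂ G e) (end₁ G e) ≡ true
  joins-end₂-end₁ e = ∨-trueʳ (end₂ G e == end₁ G e ∧ end₁ G e == end₂ G e)
                              (∧-true (==-refl (end₂ G e)) (==-refl (end₁ G e)))

  Joins-unique : ∀ {e e' x y} → Joins e x y → Joins e' x y → e ≡ e'
  Joins-unique {e} {e'} (inj₁ (refl , refl)) (inj₁ (p , q)) = simple G e e' (inj₁ (p , q))
  Joins-unique {e} {e'} (inj₁ (refl , refl)) (inj₂ (p , q)) = simple G e e' (inj₂ (p , q))
  Joins-unique {e} {e'} (inj₂ (refl , refl)) (inj₁ (p , q)) = simple G e e' (inj₂ (q , p))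
  Joins-unique {e} {e'} (inj₂ (refl , refl)) (inj₂ (p , q)) = simple G e e' (inj₁ (q , p))

  incident-end₁ : ∀ e → incident G (end₁ G e) e ≡ true
  incident-end₁ e = ∨-trueˡ _ (==-refl (end₁ G e))

  incident-end₂ : ∀ e → incident G (end₂ G e) e ≡ true
  incident-end₂ e = ∨-trueʳ (end₂ G e == end₁ G e) (==-refl (end₂ G e))

  incident-elim : ∀ {v e} → incident G v e ≡ true → v ≡ end₁ G e ⊎ v ≡ end₂ G e
  incident-elim {v} {e} p with ∨-true-elim (v == end₁ G e) _ p
  ... | inj₁ q = inj₁ (==⇒≡ {i = v} q)
  ... | inj₂ q = inj₂ (==⇒≡ {i = v} q)

  count-endpoints : ∀ (T : Fin (n G) → Bool) e →
    count (λ x → T x ∧ incident G x e) ≡ toℕ (T (end₁ G e)) + toℕ (T (end₂ G e))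
  count-endpoints T e = begin
    count (λ x → T x ∧ incident G x e)
      ≡⟨ count-cong (λ x → ∧-distribˡ-∨ (T x) _ _) ⟩
    count (λ x → at₁ x ∨ at₂ x)
      ≡⟨ ℕP.+-identityʳ _ ⟨
    count (λ x → at₁ x ∨ at₂ x) + 0
      ≡⟨ cong (count (λ x → at₁ x ∨ at₂ x) +_) (count-none at-both) ⟨
    count (λ x → at₁ x ∨ at₂ x) + count (λ x → at₁ x ∧ at₂ x)
      ≡⟨ count-∨-∧ at₁ at₂ ⟩
    count at₁ + count at₂
      ≡⟨ cong₂ _+_ (count-∧-== T (end₁ G e)) (count-∧-== T (end₂ G e)) ⟩
    toℕ (T (end₁ G e)) + toℕ (T (end₂ G e))
      ∎
    where
    open ≡-Reasoning
    at₁ at₂ : Fin (n G) → Bool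
    at₁ x = T x ∧ x == end₁ G e
    at₂ x = T x ∧ x == end₂ G e
    at-both : ∀ x → (at₁ x ∧ at₂ x) ≡ false
    at-both x = ¬-not λ p → noLoop G e
      (trans (sym (==⇒≡ {i = x} (∧-conicalʳ (T x) _ (∧-conicalˡ (at₁ x) _ p))))
             (==⇒≡ {i = x} (∧-conicalʳ (T x) _ (∧-conicalʳ (at₁ x) _ p))))

  adjacency : EdgeSet → Hall.Relation
  adjacency E x y = exists (λ e → E e ∧ joins e x y)

  IncidentIn : EdgeSet → (Fin (n G) → Bool) → Fin (n G) → Fin (m G) → Bool
  IncidentIn E T x e = (T x ∧ E e) ∧ incident G x e

  incidences-by-vertex : ∀ {d E} → RegularEdgeSet d E → ∀ T →
    sum (λ x → count (IncidentIn E T x)) ≡ count T * d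
  incidences-by-vertex {d} {E} regular T = begin
    sum (λ x → count (IncidentIn E T x)) ≡⟨ sum-cong-≗ at ⟩
    sum (λ x → toℕ (T x) * d)            ≡⟨ *-distribʳ-sum d (toℕ ∘ T) ⟨
    sum (toℕ ∘ T) * d                    ≡⟨ cong (_* d) (count≡sum T) ⟨
    count T * d                          ∎
    where
    open ≡-Reasoning
    at : ∀ x → count (IncidentIn E T x) ≡ toℕ (T x) * d
    at x with T x
    ... | true  = trans (regular x) (sym (ℕP.+-identityʳ d))
    ... | false = count-none {m G} (λ _ → refl)

  incidences-by-edge : ∀ E T →
    sum (λ x → count (IncidentIn E T x)) ≡ sum (λ e → count (λ x → IncidentIn E T x e))
  incidences-by-edge E T = begin
    sum (λ x → count (IncidentIn E T x))
      ≡⟨ sum-cong-≗ (λ x → count≡sum (IncidentIn E T x)) ⟩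
    sum (λ x → sum (λ e → toℕ (IncidentIn E T x e)))
      ≡⟨ ∑-comm (λ x e → toℕ (IncidentIn E T x e)) ⟩
    sum (λ e → sum (λ x → toℕ (IncidentIn E T x e)))
      ≡⟨ sum-cong-≗ (λ e → count≡sum (λ x → IncidentIn E T x e)) ⟨
    sum (λ e → count (λ x → IncidentIn E T x e))
      ∎
    where open ≡-Reasoning

  -- Counting the incidences between S and E from both sides gives
  -- |S| (k + 1) ≤ |N(S)| (k + 1).
  regular⇒hallCondition : ∀ {k E} → RegularEdgeSet (suc k) E → Hall.HallCondition (adjacency E)
  regular⇒hallCondition {k} {E} regular S = ℕP.*-cancelʳ-≤ (count S) (count NS) (suc k) (begin
    count S * suc k                                ≡⟨ incidences-by-vertex regular S ⟨
    sum (λ x → count (IncidentIn E S x))           ≡⟨ incidences-by-edge E S ⟩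
    sum (λ e → count (λ x → IncidentIn E S x e))   ≤⟨ sum-mono at-edge ⟩
    sum (λ e → count (λ x → IncidentIn E NS x e))  ≡⟨ incidences-by-edge E NS ⟨
    sum (λ x → count (IncidentIn E NS x))          ≡⟨ incidences-by-vertex regular NS ⟩
    count NS * suc k                               ∎)
    where
    open ℕP.≤-Reasoning
    NS = Hall.Neighbourhood (adjacency E) S
    across : ∀ e a b → joins e a b ≡ true → (S a ∧ E e) ≡ true → (NS b ∧ E e) ≡ true
    across e a b j p = ∧-true (Hall.Neighbourhood-intro (adjacency E) S {a} {b} (∧-conicalˡ (S a) _ p) a~b)
                              (∧-conicalʳ (S a) _ p)
      where
      a~b = exists-intro (λ e → E e ∧ joins e a b) e (∧-true (∧-conicalʳ (S a) _ p) j)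
    at-edge : ∀ e → count (λ x → IncidentIn E S x e) ≤ count (λ x → IncidentIn E NS x e)
    at-edge e = begin
      count (λ x → IncidentIn E S x e)
        ≡⟨ count-endpoints (λ x → S x ∧ E e) e ⟩
      toℕ (S (end₁ G e) ∧ E e) + toℕ (S (end₂ G e) ∧ E e)
        ≤⟨ ℕP.+-mono-≤ (toℕ-mono (across e _ (end₂ G e) (joins-end₁-end₂ e)))
                       (toℕ-mono (across e _ (end₁ G e) (joins-end₂-end₁ e))) ⟩
      toℕ (NS (end₂ G e) ∧ E e) + toℕ (NS (end₁ G e) ∧ E e)
        ≡⟨ ℕP.+-comm (toℕ (NS (end₂ G e) ∧ E e)) _ ⟩
      toℕ (NS (end₁ G e) ∧ E e) + toℕ (NS (end₂ G e) ∧ E e)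
        ≡⟨ count-endpoints (λ x → NS x ∧ E e) e ⟨
      count (λ x → IncidentIn E NS x e)
        ∎

  Joins⇒incident₁ : ∀ {e x y} → Joins e x y → incident G x e ≡ true
  Joins⇒incident₁ {e} (inj₁ (refl , _)) = incident-end₁ e
  Joins⇒incident₁ {e} (inj₂ (refl , _)) = incident-end₂ e

  Joins⇒incident₂ : ∀ {e x y} → Joins e x y → incident G y e ≡ true
  Joins⇒incident₂ {e} (inj₁ (_ , refl)) = incident-end₂ e
  Joins⇒incident₂ {e} (inj₂ (_ , refl)) = incident-end₁ e

  remove-perfectMatching : ∀ {k E M} → RegularEdgeSet (suc k) E → RegularEdgeSet 1 M → M ⊆ E →
    RegularEdgeSet k (λ e → E e ∧ not (M e))
  remove-perfectMatching {k} {E} {M} regular perfect M⊆E v = ℕP.suc-injective (begin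
    suc (degreeIn E∖M v)                      ≡⟨ ℕP.+-comm 1 _ ⟩
    degreeIn E∖M v + 1                        ≡⟨ cong (degreeIn E∖M v +_) (perfect v) ⟨
    degreeIn E∖M v + degreeIn M v             ≡⟨ cong₂ _+_ (count-cong outside-M) (count-cong inside-M) ⟨
    count (λ e → E∋v e ∧ not (M e)) + count (λ e → E∋v e ∧ M e) ≡⟨ count-split E∋v M ⟨
    degreeIn E v                              ≡⟨ regular v ⟩
    suc k                                     ∎)
    where
    open ≡-Reasoning
    E∖M E∋v : EdgeSet
    E∖M e = E e ∧ not (M e)
    E∋v e = E e ∧ incident G v e
    outside-M : ∀ e → ((E e ∧ incident G v e) ∧ not (M e)) ≡ ((E e ∧ not (M e)) ∧ incident G v e)
    outside-M e with E e | M e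
    ... | true  | true  = ∧-zeroʳ (incident G v e)
    ... | true  | false = ∧-identityʳ (incident G v e)
    ... | false | _     = refl
    inside-M : ∀ e → ((E e ∧ incident G v e) ∧ M e) ≡ (M e ∧ incident G v e)
    inside-M e with M e in Me
    ... | true  rewrite M⊆E e Me = ∧-identityʳ (incident G v e)
    ... | false = ∧-zeroʳ (E e ∧ incident G v e)

-- ℕtoℚ a = + a / 1 is stuck on gcd a 1 for a variable a; this puts it in normal form.
ℕtoℚ≡mkℚ : ∀ a → ℕtoℚ a ≡ mkℚ (ℤ.+ a) 0 (Coprimality.sym (Coprimality.1-coprimeTo a))
ℕtoℚ≡mkℚ a = ℚP.normalize-coprime _

ℕtoℚ-suc : ∀ a → ℕtoℚ (suc a) ≡ 1ℚ ℚ.+ ℕtoℚ a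
ℕtoℚ-suc a = ℚP.toℚᵘ-injective (ℚᵘP.≃-trans homo (ℚᵘP.≃-sym (ℚP.toℚᵘ-homo-+ 1ℚ (ℕtoℚ a))))
  where
  homo : ℚ.toℚᵘ (ℕtoℚ (suc a)) ℚᵘ.≃ (ℚ.toℚᵘ 1ℚ ℚᵘ.+ ℚ.toℚᵘ (ℕtoℚ a))
  homo rewrite ℕtoℚ≡mkℚ a | ℕtoℚ≡mkℚ (suc a) = ℚᵘ.*≡* (trans (ℤP.*-identityʳ _)
    (sym (trans (ℤP.*-identityʳ _) (cong (ℤ._+_ ℤ.1ℤ) (ℤP.*-identityʳ (ℤ.+ a))))))

ℕtoℚ-mono-≤ : ∀ {a b} → a ≤ b → ℕtoℚ a ℚ.≤ ℕtoℚ b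
ℕtoℚ-mono-≤ {a} {b} a≤b rewrite ℕtoℚ≡mkℚ a | ℕtoℚ≡mkℚ b =
  ℚ.*≤* (subst₂ ℤ._≤_ (sym (ℤP.*-identityʳ (ℤ.+ a))) (sym (ℤP.*-identityʳ (ℤ.+ b))) (ℤ.+≤+ a≤b))

ℕtoℚ-cancel-≤ : ∀ {a b} → ℕtoℚ a ℚ.≤ ℕtoℚ b → a ≤ b
ℕtoℚ-cancel-≤ {a} {b} rewrite ℕtoℚ≡mkℚ a | ℕtoℚ≡mkℚ b = λ where
  (ℚ.*≤* a≤b) →
    ℤP.drop‿+≤+ (subst₂ ℤ._≤_ (ℤP.*-identityʳ (ℤ.+ a)) (ℤP.*-identityʳ (ℤ.+ b)) a≤b)

module ΣRat = CommutativeMonoidSum ℚP.+-0-commutativeMonoid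

sumℚ≡sum : ∀ {k} (f : Fin k → ℚ) → sumℚ f ≡ ΣRat.sum f
sumℚ≡sum {zero}  f = refl
sumℚ≡sum {suc k} f = cong (f zero ℚ.+_) (sumℚ≡sum (f ∘ suc))

sumℚ-cong : ∀ {k} {f g : Fin k → ℚ} → (∀ i → f i ≡ g i) → sumℚ f ≡ sumℚ g
sumℚ-cong {f = f} {g} f≗g = trans (sumℚ≡sum f) (trans (ΣRat.sum-cong-≗ f≗g) (sym (sumℚ≡sum g)))

sumℚ-+ : ∀ {k} (f g : Fin k → ℚ) → sumℚ (λ i → f i ℚ.+ g i) ≡ sumℚ f ℚ.+ sumℚ g
sumℚ-+ f g = begin
  sumℚ (λ i → f i ℚ.+ g i)         ≡⟨ sumℚ≡sum (λ i → f i ℚ.+ g i) ⟩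
  ΣRat.sum (λ i → f i ℚ.+ g i)     ≡⟨ ΣRat.∑-distrib-+ f g ⟩
  ΣRat.sum f ℚ.+ ΣRat.sum g        ≡⟨ cong₂ ℚ._+_ (sumℚ≡sum f) (sumℚ≡sum g) ⟨
  sumℚ f ℚ.+ sumℚ g                ∎
  where open ≡-Reasoning

sumℚ-nonneg : ∀ {k} (f : Fin k → ℚ) → (∀ i → 0ℚ ℚ.≤ f i) → 0ℚ ℚ.≤ sumℚ f
sumℚ-nonneg {zero}  f _  = ℚP.≤-refl
sumℚ-nonneg {suc k} f f≥0 = ℚP.+-mono-≤ (f≥0 zero) (sumℚ-nonneg (f ∘ suc) (f≥0 ∘ suc))

weight : ∀ {k} → (Fin k → ℚ) → (Fin k → Bool) → ℚ
weight y E = sumℚ (λ e → if E e then y e else 0ℚ)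

weight-cong : ∀ {k} (y : Fin k → ℚ) {E F} → (∀ e → E e ≡ F e) → weight y E ≡ weight y F
weight-cong y E≗F = sumℚ-cong (λ e → cong (λ b → if b then y e else 0ℚ) (E≗F e))

weight-nonneg : ∀ {k} (y : Fin k → ℚ) E → (∀ e → 0ℚ ℚ.≤ y e) → 0ℚ ℚ.≤ weight y E
weight-nonneg y E y≥0 = sumℚ-nonneg _ (λ e → term (E e) e)
  where
  term : ∀ b e → 0ℚ ℚ.≤ (if b then y e else 0ℚ)
  term true  e = y≥0 e
  term false e = ℚP.≤-refl

weight-split : ∀ {k} (y : Fin k → ℚ) (E M : Fin k → Bool) →
  weight y E ≡ weight y (λ e → E e ∧ not (M e)) ℚ.+ weight y (λ e → E e ∧ M e)
weight-split y E M = trans (sumℚ-cong (λ e → split (E e) (M e) e))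
  (sumℚ-+ (λ e → if E e ∧ not (M e) then y e else 0ℚ) (λ e → if E e ∧ M e then y e else 0ℚ))
  where
  split : ∀ a b e → (if a then y e else 0ℚ) ≡
                    (if a ∧ not b then y e else 0ℚ) ℚ.+ (if a ∧ b then y e else 0ℚ)
  split true  true  e = sym (ℚP.+-identityˡ (y e))
  split true  false e = sym (ℚP.+-identityʳ (y e))
  split false b     e = refl

weight-of-ones : ∀ {k} (E : Fin k → Bool) → weight (λ _ → 1ℚ) E ≡ ℕtoℚ (count E)
weight-of-ones {zero}  E = refl
weight-of-ones {suc k} E with E zero
... | true  = trans (cong (1ℚ ℚ.+_) (weight-of-ones (E ∘ suc))) (sym (ℕtoℚ-suc (count (E ∘ suc))))
... | false = trans (ℚP.+-identityˡ _) (weight-of-ones (E ∘ suc))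

-- Regular bipartite graphs

module Bipartite (G : Graph) (c : Fin (n G) → Bool)
                 (proper : ∀ e → c (end₁ G e) ≢ c (end₂ G e)) where

  white black : Fin (m G) → Fin (n G)
  white e = if c (end₁ G e) then end₂ G e else end₁ G e
  black e = if c (end₁ G e) then end₁ G e else end₂ G e

  Joins-white-black : ∀ e → Joins G e (white e) (black e)
  Joins-white-black e with c (end₁ G e)
  ... | true  = inj₂ (refl , refl)
  ... | false = inj₁ (refl , refl)

  incident⇒white : ∀ {v e} → incident G v e ≡ true → c v ≡ false → v ≡ white e
  incident⇒white {v} {e} v∈e cv with incident-elim G {v} {e} v∈e | c (end₁ G e) in c₁
  ... | inj₁ refl | false = refl
  ... | inj₁ refl | true  = ⊥-elim (not-¬ c₁ cv)
  ... | inj₂ refl | true  = refl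
  ... | inj₂ refl | false = ⊥-elim (proper e (trans c₁ (sym cv)))

  incident⇒black : ∀ {v e} → incident G v e ≡ true → c v ≡ true → v ≡ black e
  incident⇒black {v} {e} v∈e cv with incident-elim G {v} {e} v∈e | c (end₁ G e) in c₁
  ... | inj₁ refl | true  = refl
  ... | inj₁ refl | false = ⊥-elim (not-¬ cv c₁)
  ... | inj₂ refl | false = refl
  ... | inj₂ refl | true  = ⊥-elim (proper e (trans c₁ (sym cv)))

  Joins⇒colours-differ : ∀ {e x y} → Joins G e x y → c x ≢ c y
  Joins⇒colours-differ {e} (inj₁ (refl , refl)) = proper e
  Joins⇒colours-differ {e} (inj₂ (refl , refl)) = proper e ∘ sym

  Joins⇒colour : ∀ {e x y} → Joins G e x y → c x ≡ false → c y ≡ true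
  Joins⇒colour j cx = ¬-not (Joins⇒colours-differ j ∘ trans cx ∘ sym)

  Joins⇒white-black : ∀ {e x y} → Joins G e x y → c x ≡ false → x ≡ white e × y ≡ black e
  Joins⇒white-black j cx = incident⇒white (Joins⇒incident₁ G j) cx ,
                            incident⇒black (Joins⇒incident₂ G j) (Joins⇒colour j cx)

  -- Hall's theorem for the adjacency relation on all vertices gives an injection
  -- f with every x adjacent to f x; f is then a bijection, and the edges from the
  -- white vertices u to f u form a perfect matching.
  perfectMatching-of-regular : ∀ {k E} → RegularEdgeSet G (suc k) E →
    Σ (EdgeSet G) λ M → RegularEdgeSet G 1 M × M ⊆ E
  perfectMatching-of-regular {k} {E} regular = M , perfect , M⊆E
    where
    matching = Hall.hall (adjacency G E) (regular⇒hallCondition G regular)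
    f = proj₁ matching
    f-injective = proj₂ (proj₂ matching)

    edge-to-image : ∀ x → Σ (Fin (m G)) λ e → E e ≡ true × Joins G e x (f x)
    edge-to-image x =
      let (e , p) = exists-elim _ (proj₁ (proj₂ matching) x)
      in e , ∧-conicalˡ (E e) _ p , joins⇒Joins G e x (f x) (∧-conicalʳ (E e) _ p)

    M : EdgeSet G
    M e = E e ∧ f (white e) == black e

    M⊆E : M ⊆ E
    M⊆E e = ∧-conicalˡ (E e) _

    white-partner : ∀ v → Σ (Fin (n G)) λ u → c u ≡ false × (v ≡ u ⊎ v ≡ f u)
    white-partner v with c v in cv
    ... | false = v , cv , inj₁ refl
    ... | true  = white-preimage cv (injective⇒surjective f f-injective v)
      where
      white-preimage : ∀ {v} → c v ≡ true → (∃ λ u → f u ≡ v) →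
                       Σ (Fin (n G)) λ u → c u ≡ false × (v ≡ u ⊎ v ≡ f u)
      white-preimage cfu (u , refl) = u , ¬-not u-not-black , inj₂ refl
        where
        u-not-black : c u ≢ true
        u-not-black cu = Joins⇒colours-differ (proj₂ (proj₂ (edge-to-image u))) (trans cu (sym cfu))

    perfect : RegularEdgeSet G 1 M
    perfect v = matched-through (white-partner v)
      where
      matched-through : (Σ (Fin (n G)) λ u → c u ≡ false × (v ≡ u ⊎ v ≡ f u)) →
                        count (λ e → M e ∧ incident G v e) ≡ 1
      matched-through (u , cu , v∈⟨u,fu⟩) =
        count-unique (λ e → M e ∧ incident G v e) eᵤ (∧-true M-eᵤ (v∈eᵤ v∈⟨u,fu⟩)) unique
        where
        eᵤ = proj₁ (edge-to-image u)
        Jᵤ = proj₂ (proj₂ (edge-to-image u))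
        ends = Joins⇒white-black Jᵤ cu

        M-eᵤ : M eᵤ ≡ true
        M-eᵤ = ∧-true (proj₁ (proj₂ (edge-to-image u)))
          (subst₂ (λ a b → f a == b ≡ true) (proj₁ ends) (proj₂ ends) (==-refl (f u)))

        v∈eᵤ : v ≡ u ⊎ v ≡ f u → incident G v eᵤ ≡ true
        v∈eᵤ (inj₁ v≡u)  = subst (λ t → incident G t eᵤ ≡ true) (sym v≡u) (Joins⇒incident₁ G Jᵤ)
        v∈eᵤ (inj₂ v≡fu) = subst (λ t → incident G t eᵤ ≡ true) (sym v≡fu) (Joins⇒incident₂ G Jᵤ)

        unique : ∀ e → (M e ∧ incident G v e) ≡ true → e ≡ eᵤ
        unique e p = Joins-unique G Jₑ Jᵤ
          where
          v∈e = ∧-conicalʳ (M e) _ p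
          f-white≡black : f (white e) ≡ black e
          f-white≡black = ==⇒≡ {i = f (white e)} (∧-conicalʳ (E e) _ (∧-conicalˡ (M e) _ p))
          white≡u : white e ≡ u
          white≡u = white-end v∈⟨u,fu⟩
            where
            white-end : v ≡ u ⊎ v ≡ f u → white e ≡ u
            white-end (inj₁ v≡u)  = trans (sym (incident⇒white v∈e (trans (cong c v≡u) cu))) v≡u
            white-end (inj₂ v≡fu) = f-injective (trans f-white≡black
              (trans (sym (incident⇒black v∈e (trans (cong c v≡fu) (Joins⇒colour Jᵤ cu)))) v≡fu))
          Jₑ : Joins G e u (f u)
          Jₑ = subst₂ (Joins G e) white≡u (trans (sym f-white≡black) (cong f white≡u)) (Joins-white-black e)

  -- Peel off one perfect matching and recurse on the remaining k-regular edge set.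
  weight-of-regular : ∀ k {E} → RegularEdgeSet G k E →
    (y : Fin (m G) → ℚ) → (∀ e → 0ℚ ℚ.≤ y e) →
    (∀ M → RegularEdgeSet G 1 M → M ⊆ E → 1ℚ ℚ.≤ weight y M) →
    ℕtoℚ k ℚ.≤ weight y E
  weight-of-regular zero    {E} _       y y≥0 _      = weight-nonneg y E y≥0
  weight-of-regular (suc k) {E} regular y y≥0 heavy = peel (perfectMatching-of-regular regular)
    where
    peel : (Σ (EdgeSet G) λ M → RegularEdgeSet G 1 M × M ⊆ E) → ℕtoℚ (suc k) ℚ.≤ weight y E
    peel (M , perfect , M⊆E) = begin
      ℕtoℚ (suc k)                                        ≡⟨ ℕtoℚ-suc k ⟩
      1ℚ ℚ.+ ℕtoℚ k                                       ≡⟨ ℚP.+-comm 1ℚ (ℕtoℚ k) ⟩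
      ℕtoℚ k ℚ.+ 1ℚ                                       ≤⟨ ℚP.+-mono-≤ rest (heavy M perfect M⊆E) ⟩
      weight y E∖M ℚ.+ weight y M                         ≡⟨ cong (weight y E∖M ℚ.+_) (weight-cong y E∧M≗M) ⟨
      weight y E∖M ℚ.+ weight y (λ e → E e ∧ M e)         ≡⟨ weight-split y E M ⟨
      weight y E                                          ∎
      where
      open ℚP.≤-Reasoning
      E∖M : EdgeSet G
      E∖M e = E e ∧ not (M e)
      rest : ℕtoℚ k ℚ.≤ weight y E∖M
      rest = weight-of-regular k (remove-perfectMatching G regular perfect M⊆E) y y≥0
               (λ M' perfect' M'⊆E∖M → heavy M' perfect' (λ e → ∧-conicalˡ (E e) _ ∘ M'⊆E∖M e))
      E∧M≗M : ∀ e → (E e ∧ M e) ≡ M e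
      E∧M≗M e with M e in Me
      ... | true  = trans (∧-identityʳ (E e)) (M⊆E e Me)
      ... | false = ∧-zeroʳ (E e)

∣∣≡count : ∀ {k} (F : Subset k) → ∣ F ∣ ≡ count (lookup F)
∣∣≡count []          = refl
∣∣≡count (true ∷ F)  = cong suc (∣∣≡count F)
∣∣≡count (false ∷ F) = ∣∣≡count F

star : (G : Graph) → Fin (n G) → Subset (m G)
star G v = tabulate (incident G v)

∣star∣ : ∀ G v → ∣ star G v ∣ ≡ degree G v
∣star∣ G v = trans (∣∣≡count (star G v)) (count-cong (lookup∘tabulate (incident G v)))

star-precludes : ∀ G v → ¬ HasPerfectMatchingAfterDeleting G (star G v)
star-precludes G v (M , perfect , avoids) =
  let (e , p) = count-witness _ (ℕP.≤-reflexive (sym (perfect v)))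
  in not-¬ (trans (lookup∘tabulate (incident G v) e) (∧-conicalʳ (lookup M e) _ p))
           (avoids e (∧-conicalˡ (lookup M e) _ p))

indicator : ∀ {k} → Subset k → Fin k → ℚ
indicator F e = if lookup F e then 1ℚ else 0ℚ

weight-indicator : ∀ {k} (F : Subset k) M →
  weight (indicator F) M ≡ ℕtoℚ (count (λ e → M e ∧ lookup F e))
weight-indicator F M =
  trans (sumℚ-cong (λ e → pointwise (M e) e)) (weight-of-ones (λ e → M e ∧ lookup F e))
  where
  pointwise : ∀ b e → (if b then indicator F e else 0ℚ) ≡ (if b ∧ lookup F e then 1ℚ else 0ℚ)
  pointwise true  e = refl
  pointwise false e = refl

objective-indicator : ∀ G (F : Subset (m G)) → objective G (indicator F) ≡ ℕtoℚ ∣ F ∣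
objective-indicator G F = trans (weight-of-ones (lookup F)) (cong ℕtoℚ (sym (∣∣≡count F)))

-- This is the inequality mp_f ≤ mp.
indicator-feasible : ∀ G F → ¬ HasPerfectMatchingAfterDeleting G F → Feasible G (indicator F)
indicator-feasible G F precluded = nonneg , meets
  where
  nonneg : ∀ e → 0ℚ ℚ.≤ indicator F e
  nonneg e with lookup F e
  ... | true  = ℕtoℚ-mono-≤ {0} {1} z≤n
  ... | false = ℚP.≤-refl
  meets : ∀ M → IsPerfectMatching G M → 1ℚ ℚ.≤ incidenceDot G M (indicator F)
  meets M perfect with FinP.any? (λ e → lookup M e ∧ lookup F e BoolP.≟ true)
  ... | yes (e , p) = subst (1ℚ ℚ.≤_) (sym (weight-indicator F (lookup M)))
                        (ℕtoℚ-mono-≤ (count-≥1 (λ e → lookup M e ∧ lookup F e) e p))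
  ... | no  disjoint =
    ⊥-elim (precluded (M , perfect , λ e Me → ¬-not (λ Fe → disjoint (e , ∧-true Me Fe))))

tabulate-perfect : ∀ G {M} → RegularEdgeSet G 1 M → IsPerfectMatching G (tabulate M)
tabulate-perfect G {M} perfect v =
  trans (count-cong (λ e → cong (_∧ incident G v e) (lookup∘tabulate M e))) (perfect v)

regular-bipartite-objective : ∀ {r} G → Regular r G → Bipartite G →
  ∀ y → Feasible G y → ℕtoℚ r ℚ.≤ objective G y
regular-bipartite-objective {r} G regular (c , proper) y (y≥0 , heavy) =
  Bipartite.weight-of-regular G c proper r regular y y≥0 λ M perfect _ →
    subst (1ℚ ℚ.≤_) (weight-cong y (lookup∘tabulate M)) (heavy (tabulate M) (tabulate-perfect G perfect))

corollary3p12 : (r : ℕ) (G : Graph) → n G ≥ 1 → EvenOrder G →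
    Regular r G → Bipartite G →
    FractionalMatchingPreclusionNumber G (ℕtoℚ r) × MatchingPreclusionNumber G r
corollary3p12 r G n≥1 _ regular bipartite =
  ( (indicator F★ , indicator-feasible G F★ F★-precludes , objective-F★)
  , lower-bound )
  , ( (F★ , ∣F★∣≡r , F★-precludes)
    , λ F precluded → ℕtoℚ-cancel-≤ (subst (ℕtoℚ r ℚ.≤_) (objective-indicator G F)
                                        (lower-bound (indicator F) (indicator-feasible G F precluded))) )
  where
  v = Fin.fromℕ< n≥1
  F★ = star G v
  F★-precludes = star-precludes G v
  ∣F★∣≡r = trans (∣star∣ G v) (regular v)
  objective-F★ = trans (objective-indicator G F★) (cong ℕtoℚ ∣F★∣≡r)
  lower-bound = regular-bipartite-objective G regular bipartite
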